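{- Let $q$ be a power of a prime $p$, and let $n,k,d$ satisfy $d\le k\le n-d$ with $k$ being $(d,p)$-good. Then every function in $\mathcal{P}_d(n,k,\mathbb{Z}_q)$ can be written uniquely as a $\mathbb{Z}_q$-linear combination of the (restrictions to $\{0,1\}^n_k$ of the) monomials in $\mathcal{H}_d$.
   Context: $\{0,1\}^n_k$ is the set of strings in $\{0,1\}^n$ of Hamming weight $k$. $\mathcal{P}_d(n,k,\mathbb{Z}_q)$ is the set of functions $\{0,1\}^n_k\to\mathbb{Z}_q$ expressible as a multilinear polynomial of degree at most $d$ with coefficients in $\mathbb{Z}_q$. $\mathcal{H}_d=\{\prod_{i\in T}x_i : T\subseteq[n],|T|=d\}$ is the set of homogeneous multilinear monomials of degree exactly $d$. For a prime $p$ and positive integer $d$, an integer $k\ge d$ is $(d,p)$-good if, writing $k=\sum_{j=0}^m a_jp^j$ and $d=\sum_{j=0}^{\ell}b_jp^j$ in base $p$ (digits in $\{0,\dots,p-1\}$, $b_\ell>0$), one has $a_j=b_j$ for all $j<\ell$ and $a_\ell\ge b_\ell$. -}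

module Defs where

open import Data.Nat using (ℕ; zero; suc; _+_; _*_; _≤_; _<_; NonZero)
open import Data.Nat.DivMod using (_%_; _/_; _mod_)
open import Data.Bool using (Bool; true; false; _∧_)
open import Data.Vec using (Vec; []; _∷_)
open import Data.List using (List; []; _∷_; _++_; map)
open import Data.Fin using (Fin; toℕ)
open import Data.Product using (Σ; _×_; ∃)
open import Relation.Binary.PropositionalEquality using (_≡_; _≢_)

-- Points of {0,1}^n (true = 1) and subsets T ⊆ [n] are both encoded as Vec Bool n.

weight : ∀ {n} → Vec Bool n → ℕ
weight []          = 0
weight (true  ∷ x) = suc (weight x)
weight (false ∷ x) = weight x

InSlice : ∀ {n} → ℕ → Vec Bool n → Set
InSlice k x = weight x ≡ k

monomial : ∀ {n} → Vec Bool n → Vec Bool n → ℕ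
monomial []          []          = 1
monomial (true  ∷ T) (true  ∷ x) = monomial T x
monomial (true  ∷ T) (false ∷ x) = 0
monomial (false ∷ T) (_     ∷ x) = monomial T x

allVecs : (n : ℕ) → List (Vec Bool n)
allVecs zero    = [] ∷ []
allVecs (suc n) = map (true ∷_) (allVecs n) ++ map (false ∷_) (allVecs n)

-- A multilinear polynomial over ℤ_q is a coefficient function c : subsets → ℤ_q
-- (ℤ_q is represented by Fin q).  Evaluation at x, computed in ℤ_q.
evalSum : ∀ {n q} → (Vec Bool n → Fin q) → Vec Bool n → List (Vec Bool n) → ℕ
evalSum c x []       = 0
evalSum c x (T ∷ Ts) = toℕ (c T) * monomial T x + evalSum c x Ts

eval : ∀ {n q} .{{_ : NonZero q}} → (Vec Bool n → Fin q) → Vec Bool n → Fin q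
eval {n} {q} c x = evalSum c x (allVecs n) mod q

DegreeAtMost : ∀ {n q} → ℕ → (Vec Bool n → Fin q) → Set
DegreeAtMost d c = ∀ T → d < weight T → toℕ (c T) ≡ 0

-- c is a combination of monomials in H_d: c T = 0 whenever |T| ≠ d
SupportedOnH : ∀ {n q} → ℕ → (Vec Bool n → Fin q) → Set
SupportedOnH d c = ∀ T → weight T ≢ d → toℕ (c T) ≡ 0

Represents : ∀ {n q} .{{_ : NonZero q}} → ℕ → (Vec Bool n → Fin q) → (Vec Bool n → Fin q) → Set
Represents k c f = ∀ x → InSlice k x → f x ≡ eval c x

-- f (a function on {0,1}^n_k, only its values on the slice matter) lies in P_d(n,k,ℤ_q)
InP : ∀ {n q} .{{_ : NonZero q}} → ℕ → ℕ → (Vec Bool n → Fin q) → Set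
InP {n} {q} d k f = Σ (Vec Bool n → Fin q) λ c → DegreeAtMost d c × Represents k c f

digit : (p : ℕ) .{{_ : NonZero p}} → ℕ → ℕ → ℕ
digit p zero    m = m % p
digit p (suc j) m = digit p j (m / p)

Good : (p : ℕ) .{{_ : NonZero p}} → ℕ → ℕ → Set
Good p d k =
  d ≤ k ×
  ∃ λ ℓ → 0 < digit p ℓ d × (∀ j → ℓ < j → digit p j d ≡ 0)
        × (∀ j → j < ℓ → digit p j k ≡ digit p j d)
        × digit p ℓ d ≤ digit p ℓ k

-- On the slice |x| = k a monomial x^S with |S| ≤ d can be raised to degree d: the sum of x^T over the d-sets
-- T ⊇ S is C(k − |S|, d − |S|) · x^S, and (d,p)-goodness makes each such binomial coefficient prime to p,
-- hence a unit mod q. For uniqueness, let δ be a homogeneous degree-d combination vanishing on the slice.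
-- Exchanging a 1 and a 0 between two coordinates gives the same situation for (n − 2, k − 1, d − 1), so by
-- induction δ is invariant under such exchanges, i.e. constant (≡ c) on d-sets; evaluating at a point of the
-- slice gives c · C(k, d) ≡ 0, so c ≡ 0.
-- Goodness means k = d + E p^ℓ with v_p(E p^ℓ + i) = v_p(i) for 0 < i ≤ d, and then p ∤ C(E p^ℓ + r, r).

module Submission where

module Binomials where
  open import Defs
  open import Data.Nat
  open import Data.Nat.Properties
  open import Data.Nat.DivMod
  open import Data.Nat.Divisibility
  open import Data.Nat.Combinatorics using (_C_; nC1≡n; nCk+nC[k+1]≡[n+1]C[k+1])
  open import Data.Nat.Primality using (Prime; prime⇒nonZero; prime⇒nonTrivial; euclidsLemma)
  open import Data.Nat.Induction using (<-rec)
  open import Data.Nat.Tactic.RingSolver using (solve-∀)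
  open import Data.Product using (∃-syntax; _×_; _,_)
  open import Function using (_∘_)
  open import Data.Sum using (inj₁; inj₂)
  open import Relation.Nullary using (yes; no; contradiction)
  open import Relation.Binary.PropositionalEquality

  C-absorption : ∀ n r → (suc n C suc r) * suc r ≡ suc n * (n C r)
  C-absorption zero    zero    = refl
  C-absorption zero    (suc r) = refl
  C-absorption (suc n) zero    = trans (*-identityʳ (suc (suc n) C 1)) (trans (nC1≡n (suc (suc n))) (sym (*-identityʳ (suc (suc n)))))
  C-absorption (suc n) (suc r) = begin
    (suc (suc n) C suc (suc r)) * suc (suc r)  ≡⟨ cong (_* suc (suc r)) (nCk+nC[k+1]≡[n+1]C[k+1] (suc n) (suc r)) ⟨
    (a + b) * suc (suc r)                      ≡⟨ expand a b r ⟩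
    a * suc r + a + b * suc (suc r)            ≡⟨ cong₂ (λ x y → x + a + y) (C-absorption n r) (C-absorption n (suc r)) ⟩
    suc n * (n C r) + a + suc n * (n C suc r)  ≡⟨ collect n (n C r) a (n C suc r) ⟩
    suc n * (n C r + n C suc r) + a            ≡⟨ cong (λ x → suc n * x + a) (nCk+nC[k+1]≡[n+1]C[k+1] n r) ⟩
    suc n * a + a                              ≡⟨ +-comm (suc n * a) a ⟩
    suc (suc n) * a                            ∎
    where
    open ≡-Reasoning
    a = suc n C suc r
    b = suc n C suc (suc r)
    expand : ∀ a b r → (a + b) * suc (suc r) ≡ a * suc r + a + b * suc (suc r)
    expand = solve-∀
    collect : ∀ n x a y → suc n * x + a + suc n * y ≡ suc n * (x + y) + a
    collect = solve-∀

  record SameValuation (p a b : ℕ) : Set where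
    constructor sameValuation
    field
      exponent α β : ℕ
      a≡p^e*α    : a ≡ p ^ exponent * α
      b≡p^e*β    : b ≡ p ^ exponent * β
      p∤α        : p ∤ α
      p∤β        : p ∤ β

  module _ {p : ℕ} (prime : Prime p) where

    private instance
      p≢0 : NonZero p
      p≢0 = prime⇒nonZero prime

    1<p : 1 < p
    1<p = nonTrivial⇒n>1 p {{prime⇒nonTrivial prime}}

    p∤1 : p ∤ 1
    p∤1 p∣1 = <⇒≢ 1<p (sym (∣1⇒≡1 p∣1))

    -- In (t + r + 1) C (r + 1) · (r + 1) = (t + r + 1) · (t + r) C r the p-parts of r + 1 and t + r + 1 cancel.
    p∤[t+r]Cr : ∀ t r → (∀ i → 0 < i → i ≤ r → SameValuation p (t + i) i) → p ∤ (t + r) C r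
    p∤[t+r]Cr t zero    _ = p∤1
    p∤[t+r]Cr t (suc r) v p∣C with v (suc r) (s≤s z≤n) ≤-refl
    ... | sameValuation s α β t+r+1≡ r+1≡ p∤α p∤β
      with euclidsLemma α ((t + r) C r) prime (subst (p ∣_) C*β≡α*C′ (∣-trans p∣C (m∣m*n β)))
      where
      instance
        p^s≢0 : NonZero (p ^ s)
        p^s≢0 = m^n≢0 p s
      C*β≡α*C′ : ((t + suc r) C suc r) * β ≡ α * ((t + r) C r)
      C*β≡α*C′ = *-cancelˡ-≡ (((t + suc r) C suc r) * β) (α * ((t + r) C r)) (p ^ s) (begin
        p ^ s * (((t + suc r) C suc r) * β)    ≡⟨ x*[y*z]≡y*[x*z] (p ^ s) ((t + suc r) C suc r) β ⟩
        ((t + suc r) C suc r) * (p ^ s * β)    ≡⟨ cong (((t + suc r) C suc r) *_) r+1≡ ⟨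
        ((t + suc r) C suc r) * suc r          ≡⟨ cong (λ m → (m C suc r) * suc r) (+-suc t r) ⟩
        (suc (t + r) C suc r) * suc r          ≡⟨ C-absorption (t + r) r ⟩
        suc (t + r) * ((t + r) C r)            ≡⟨ cong (_* ((t + r) C r)) (trans (sym (+-suc t r)) t+r+1≡) ⟩
        p ^ s * α * ((t + r) C r)              ≡⟨ *-assoc (p ^ s) α _ ⟩
        p ^ s * (α * ((t + r) C r))            ∎)
        where
        open ≡-Reasoning
        x*[y*z]≡y*[x*z] : ∀ x y z → x * (y * z) ≡ y * (x * z)
        x*[y*z]≡y*[x*z] = solve-∀
    ... | inj₁ p∣α = p∤α p∣α
    ... | inj₂ p∣C′ = p∤[t+r]Cr t r (λ i 0<i i≤r → v i 0<i (m≤n⇒m≤1+n i≤r)) p∣C′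

    p-power-decomposition : ∀ i → 0 < i → ∃[ s ] ∃[ β ] i ≡ p ^ s * β × p ∤ β
    p-power-decomposition = <-rec _ decompose
      where
      decompose : ∀ i → (∀ {m} → m < i → 0 < m → ∃[ s ] ∃[ β ] m ≡ p ^ s * β × p ∤ β) →
                  0 < i → ∃[ s ] ∃[ β ] i ≡ p ^ s * β × p ∤ β
      decompose i rec 0<i with p ∣? i
      ... | no p∤i = 0 , i , sym (+-identityʳ i) , p∤i
      ... | yes (divides zero i≡0) = contradiction i≡0 (>⇒≢ 0<i)
      ... | yes (divides m@(suc _) i≡m*p) with rec m<i (s≤s z≤n)
        where
        m<i : m < i
        m<i = subst (m <_) (sym i≡m*p) (m<m*n m p 1<p)
      ...   | s , β , m≡p^s*β , p∤β = suc s , β , trans i≡m*p (trans (cong (_* p) m≡p^s*β) (reassoc (p ^ s) β p)) , p∤β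
        where
        reassoc : ∀ x β p → x * β * p ≡ p * x * β
        reassoc = solve-∀

    record CommonLowPart (ℓ k d : ℕ) : Set where
      field
        K D ρ   : ℕ
        k≡      : k ≡ K * p ^ ℓ + ρ
        d≡      : d ≡ D * p ^ ℓ + ρ
        ρ<p^ℓ   : ρ < p ^ ℓ
        digit-K : ∀ j → digit p (ℓ + j) k ≡ digit p j K
        digit-D : ∀ j → digit p (ℓ + j) d ≡ digit p j D

    commonLowPart : ∀ ℓ k d → (∀ j → j < ℓ → digit p j k ≡ digit p j d) → CommonLowPart ℓ k d
    commonLowPart zero k d _ = record
      { K = k ; D = d ; ρ = 0 ; k≡ = m≡m*1+0 k ; d≡ = m≡m*1+0 d ; ρ<p^ℓ = s≤s z≤n
      ; digit-K = λ _ → refl ; digit-D = λ _ → refl }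
      where
      m≡m*1+0 : ∀ m → m ≡ m * 1 + 0
      m≡m*1+0 = solve-∀
    commonLowPart (suc ℓ) k d agree = record
      { K = K ; D = D ; ρ = k % p + ρ * p
      ; k≡ = lift k {K} (m≡m%n+[m/n]*n k p) k≡
      ; d≡ = lift d {D} (trans (m≡m%n+[m/n]*n d p) (cong (_+ d / p * p) (sym k%p≡d%p))) d≡
      ; ρ<p^ℓ = <-≤-trans (+-monoˡ-< (ρ * p) (m%n<n k p)) (subst (_≤ p * p ^ ℓ) (*-comm p (suc ρ)) (*-monoʳ-≤ p ρ<p^ℓ))
      ; digit-K = digit-K ; digit-D = digit-D }
      where
      open CommonLowPart (commonLowPart ℓ (k / p) (d / p) (λ j j<ℓ → agree (suc j) (s≤s j<ℓ)))
      k%p≡d%p : k % p ≡ d % p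
      k%p≡d%p = agree 0 (s≤s z≤n)
      lift : ∀ m {M} → m ≡ k % p + m / p * p → m / p ≡ M * p ^ ℓ + ρ → m ≡ M * (p * p ^ ℓ) + (k % p + ρ * p)
      lift m {M} m≡ m/p≡ = trans m≡ (trans (cong (λ x → k % p + x * p) m/p≡) (regroup (k % p) M (p ^ ℓ) ρ p))
        where
        regroup : ∀ r M P ρ p → r + (M * P + ρ) * p ≡ M * (p * P) + (r + ρ * p)
        regroup = solve-∀

    digits-zero⇒zero : ∀ m → (∀ j → digit p j m ≡ 0) → m ≡ 0
    digits-zero⇒zero = <-rec _ go
      where
      go : ∀ m → (∀ {m′} → m′ < m → (∀ j → digit p j m′ ≡ 0) → m′ ≡ 0) → (∀ j → digit p j m ≡ 0) → m ≡ 0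
      go zero    _   _     = refl
      go (suc m) rec zeros = contradiction (begin
        suc m                       ≡⟨ m≡m%n+[m/n]*n (suc m) p ⟩
        suc m % p + suc m / p * p   ≡⟨ cong₂ (λ r q → r + q * p) (zeros 0) (rec (m/n<m (suc m) p 1<p) (zeros ∘ suc)) ⟩
        0                           ∎) (λ ())
        where open ≡-Reasoning

    -- Goodness in arithmetic form: D is the leading digit of d, at position ℓ, and (D + E) mod p is the digit of k there.
    record GoodShape (d k : ℕ) : Set where
      field
        ℓ D E       : ℕ
        k≡d+E*p^ℓ   : k ≡ d + E * p ^ ℓ
        d<[1+D]*p^ℓ : d < suc D * p ^ ℓ
        D<p         : D < p
        D≤[D+E]%p   : D ≤ (D + E) % p

    good⇒goodShape : ∀ d k → Good p d k → GoodShape d k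
    good⇒goodShape d k (d≤k , ℓ , _ , high , low , top) = record
      { ℓ = ℓ ; D = D ; E = K ∸ D
      ; k≡d+E*p^ℓ = begin
          k                               ≡⟨ k≡ ⟩
          K * p ^ ℓ + ρ                   ≡⟨ cong (λ x → x * p ^ ℓ + ρ) K≡D+E ⟩
          (D + (K ∸ D)) * p ^ ℓ + ρ       ≡⟨ regroup D (K ∸ D) (p ^ ℓ) ρ ⟩
          (D * p ^ ℓ + ρ) + (K ∸ D) * p ^ ℓ ≡⟨ cong (_+ (K ∸ D) * p ^ ℓ) d≡ ⟨
          d + (K ∸ D) * p ^ ℓ             ∎
      ; d<[1+D]*p^ℓ = subst (_< suc D * p ^ ℓ) (sym d≡)
          (subst (D * p ^ ℓ + ρ <_) (+-comm (D * p ^ ℓ) (p ^ ℓ)) (+-monoʳ-< (D * p ^ ℓ) ρ<p^ℓ))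
      ; D<p = D<p
      ; D≤[D+E]%p = subst (λ x → D ≤ x % p) K≡D+E (subst₂ _≤_ digit-d digit-k top) }
      where
      open CommonLowPart (commonLowPart ℓ k d low)
      open ≡-Reasoning
      instance
        p^ℓ≢0 : NonZero (p ^ ℓ)
        p^ℓ≢0 = m^n≢0 p ℓ
      D<p : D < p
      D<p = m/n≡0⇒m<n (digits-zero⇒zero (D / p) λ j →
        trans (sym (digit-D (suc j))) (high (ℓ + suc j) (m<m+n ℓ (s≤s z≤n))))
      digit-d : digit p ℓ d ≡ D
      digit-d = trans (cong (λ i → digit p i d) (sym (+-identityʳ ℓ))) (trans (digit-D 0) (m<n⇒m%n≡m D<p))
      digit-k : digit p ℓ k ≡ K % p
      digit-k = trans (cong (λ i → digit p i k) (sym (+-identityʳ ℓ))) (digit-K 0)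
      K≡D+E : K ≡ D + (K ∸ D)
      K≡D+E = sym (m+[n∸m]≡n (*-cancelʳ-≤ D K (p ^ ℓ) (+-cancelʳ-≤ ρ _ _ (subst₂ _≤_ d≡ k≡ d≤k))))
      regroup : ∀ D E P ρ → (D + E) * P + ρ ≡ (D * P + ρ) + E * P
      regroup = solve-∀

    module _ {d k : ℕ} (shape : GoodShape d k) where
      open GoodShape shape

      private instance
        p^ℓ≢0 : NonZero (p ^ ℓ)
        p^ℓ≢0 = m^n≢0 p ℓ

      p∤E+c : ∀ c → 0 < c → c ≤ D → p ∤ E + c
      p∤E+c c 0<c c≤D p∣E+c = >⇒∤ {{>-nonZero 0<w}} w<p (∣m+n∣m⇒∣n (subst (p ∣_) E+c≡ p∣E+c) (n∣m*n Q))
        where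
        r = (D + E) % p
        Q = (D + E) / p
        w = (r ∸ D) + c
        0<w : 0 < w
        0<w = <-≤-trans 0<c (m≤n+m c (r ∸ D))
        w<p : w < p
        w<p = ≤-<-trans (+-monoʳ-≤ (r ∸ D) c≤D) (subst (_< p) (trans (sym (m+[n∸m]≡n D≤[D+E]%p)) (+-comm D (r ∸ D))) (m%n<n (D + E) p))
        E+c≡ : E + c ≡ Q * p + w
        E+c≡ = +-cancelˡ-≡ D _ _ (begin
          D + (E + c)                 ≡⟨ +-assoc D E c ⟨
          D + E + c                   ≡⟨ cong (_+ c) (m≡m%n+[m/n]*n (D + E) p) ⟩
          r + Q * p + c               ≡⟨ cong (λ x → x + Q * p + c) (m+[n∸m]≡n D≤[D+E]%p) ⟨
          D + (r ∸ D) + Q * p + c     ≡⟨ regroup D (r ∸ D) (Q * p) c ⟩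
          D + (Q * p + w)             ∎)
          where
          open ≡-Reasoning
          regroup : ∀ D x y c → D + x + y + c ≡ D + (y + (x + c))
          regroup = solve-∀

      shifted-sameValuation : ∀ i → 0 < i → i ≤ d → SameValuation p (E * p ^ ℓ + i) i
      shifted-sameValuation i 0<i i≤d with p ^ ℓ ∣? i
      ... | yes (divides c i≡c*p^ℓ) =
        sameValuation ℓ (E + c) c
          (trans (cong (E * p ^ ℓ +_) i≡c*p^ℓ) (trans (sym (*-distribʳ-+ (p ^ ℓ) E c)) (*-comm (E + c) (p ^ ℓ))))
          (trans i≡c*p^ℓ (*-comm c (p ^ ℓ))) (p∤E+c c 0<c c≤D) (>⇒∤ {{>-nonZero 0<c}} (≤-<-trans c≤D D<p))
        where
        0<c : 0 < c
        0<c = n≢0⇒n>0 λ { refl → >⇒≢ 0<i i≡c*p^ℓ }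
        c≤D : c ≤ D
        c≤D = ≤-pred (*-cancelʳ-< _ c (suc D) (subst (_< suc D * p ^ ℓ) i≡c*p^ℓ (≤-<-trans i≤d d<[1+D]*p^ℓ)))
      ... | no p^ℓ∤i with p-power-decomposition i 0<i
      ...   | s , β , i≡p^s*β , p∤β =
        sameValuation s (E * p ^ suc u + β) β
          (trans (cong₂ (λ x y → E * x + y) p^ℓ≡ i≡p^s*β) (factor E (p ^ s) (p ^ suc u) β)) i≡p^s*β
          (λ p∣α → p∤β (∣m+n∣m⇒∣n p∣α (∣-trans (m∣m*n (p ^ u)) (n∣m*n E))))
          p∤β
        where
        s<ℓ : s < ℓ
        s<ℓ = ≰⇒> λ ℓ≤s → p^ℓ∤i (subst (p ^ ℓ ∣_) (sym i≡p^s*β)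
          (∣-trans (subst (p ^ ℓ ∣_) (trans (sym (^-distribˡ-+-* p ℓ (s ∸ ℓ))) (cong (p ^_) (m+[n∸m]≡n ℓ≤s)))
                     (m∣m*n (p ^ (s ∸ ℓ))))
                   (m∣m*n β)))
        u = ℓ ∸ suc s
        p^ℓ≡ : p ^ ℓ ≡ p ^ s * p ^ suc u
        p^ℓ≡ = trans (cong (p ^_) (trans (sym (m+[n∸m]≡n s<ℓ)) (sym (+-suc s u)))) (^-distribˡ-+-* p s (suc u))
        factor : ∀ E x y β → E * (x * y) + x * β ≡ x * (E * y + β)
        factor = solve-∀

    good⇒p∤binomials : ∀ {d k} → Good p d k → ∀ j → p ∤ (k ∸ j) C (d ∸ j)
    good⇒p∤binomials {d} {k} good j with j ≤? d
    ... | no j≰d rewrite m≤n⇒m∸n≡0 (≰⇒≥ j≰d) = p∤1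
    ... | yes j≤d = subst (λ m → p ∤ m C (d ∸ j)) (sym k∸j≡t+[d∸j])
          (p∤[t+r]Cr t (d ∸ j) λ i 0<i i≤d∸j → shifted-sameValuation shape i 0<i (≤-trans i≤d∸j (m∸n≤m d j)))
      where
      shape = good⇒goodShape d k good
      open GoodShape shape
      t = E * p ^ ℓ
      k∸j≡t+[d∸j] : k ∸ j ≡ t + (d ∸ j)
      k∸j≡t+[d∸j] = trans (cong (_∸ j) k≡d+E*p^ℓ) (trans (+-∸-comm t j≤d) (+-comm (d ∸ j) t))

module SliceRepresentation where
  open import Defs
  open import Data.Nat as ℕ using (ℕ; zero; suc; _∸_; z≤n; s≤s)
  import Data.Nat.Properties as ℕ
  open import Data.Nat.Combinatorics using (_C_; nCk+nC[k+1]≡[n+1]C[k+1])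
  open import Data.Integer using (ℤ; +_; 0ℤ; 1ℤ; _+_; _*_; _-_; -_)
  open import Data.Integer.Properties using (*-distribˡ-+; *-distribʳ-+; *-zeroʳ; *-identityˡ; +-identityˡ; +-identityʳ; *-identityʳ)
  open import Data.Integer.Divisibility.Signed using (_∣_; divides; ∣m∣n⇒∣m+n; ∣m∣n⇒∣m-n; ∣m⇒∣-m; ∣n⇒∣m*n)
  open import Data.Integer.Tactic.RingSolver using (solve-∀)
  open import Data.Bool using (Bool; true; false; if_then_else_)
  open import Data.Vec using (Vec; []; _∷_; insertAt; replicate)
  open import Data.Fin using (Fin)
  import Data.Fin as Fin
  open import Data.Product using (Σ-syntax; ∃-syntax; _×_; _,_; proj₁; proj₂)
  open import Data.Sum using (_⊎_; inj₁; inj₂)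
  open import Data.Unit using (⊤; tt)
  open import Function using (_∘_)
  open import Relation.Nullary using (yes; no; does)
  open import Relation.Nullary.Decidable using (dec-true; dec-false)
  open import Relation.Binary.PropositionalEquality
  open import Relation.Binary.Bundles using (Setoid)
  import Relation.Binary.Reasoning.Setoid as SetoidReasoning
  open import Level using (0ℓ)

  infix 4 _≡_mod_
  record _≡_mod_ (a b m : ℤ) : Set where
    constructor congruent
    field m∣a-b : m ∣ a - b
  open _≡_mod_ public using (m∣a-b)

  module _ {m : ℤ} where

    ≡⇒≡-mod : ∀ {a b} → a ≡ b → a ≡ b mod m
    ≡⇒≡-mod {a} refl = congruent (divides 0ℤ (a-a≡0*m a m))
      where
      a-a≡0*m : ∀ a m → a - a ≡ 0ℤ * m
      a-a≡0*m = solve-∀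

    ≡-mod-refl : ∀ {a} → a ≡ a mod m
    ≡-mod-refl = ≡⇒≡-mod refl

    ≡-mod-sym : ∀ {a b} → a ≡ b mod m → b ≡ a mod m
    ≡-mod-sym {a} {b} (congruent m∣a-b) = congruent (subst (m ∣_) (-[a-b]≡b-a a b) (∣m⇒∣-m m∣a-b))
      where
      -[a-b]≡b-a : ∀ a b → - (a - b) ≡ b - a
      -[a-b]≡b-a = solve-∀

    ≡-mod-trans : ∀ {a b c} → a ≡ b mod m → b ≡ c mod m → a ≡ c mod m
    ≡-mod-trans {a} {b} {c} (congruent m∣a-b) (congruent m∣b-c) = congruent (subst (m ∣_) (telescope a b c) (∣m∣n⇒∣m+n m∣a-b m∣b-c))
      where
      telescope : ∀ a b c → (a - b) + (b - c) ≡ a - c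
      telescope = solve-∀

    ≡-mod-∣ : ∀ {a b} → a ≡ b mod m → m ∣ b → m ∣ a
    ≡-mod-∣ {a} {b} (congruent m∣a-b) m∣b = subst (m ∣_) (a-b+b≡a a b) (∣m∣n⇒∣m+n m∣a-b m∣b)
      where
      a-b+b≡a : ∀ a b → (a - b) + b ≡ a
      a-b+b≡a = solve-∀

    *-congʳ-mod : ∀ c {a b} → a ≡ b mod m → a * c ≡ b * c mod m
    *-congʳ-mod c {a} {b} (congruent m∣a-b) = congruent (subst (m ∣_) ([a-b]*c≡a*c-b*c a b c) (∣n⇒∣m*n c m∣a-b))
      where
      [a-b]*c≡a*c-b*c : ∀ a b c → c * (a - b) ≡ a * c - b * c
      [a-b]*c≡a*c-b*c = solve-∀

  ≡-mod-setoid : ℤ → Setoid 0ℓ 0ℓ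
  ≡-mod-setoid m = record
    { Carrier = ℤ
    ; _≈_ = λ a b → a ≡ b mod m
    ; isEquivalence = record { refl = ≡-mod-refl ; sym = ≡-mod-sym ; trans = ≡-mod-trans }
    }

  module ≡-mod-Reasoning (m : ℤ) = SetoidReasoning (≡-mod-setoid m)

  sumCube : (n : ℕ) → (Vec Bool n → ℤ) → ℤ
  sumCube zero    f = f []
  sumCube (suc n) f = sumCube n (f ∘ (true ∷_)) + sumCube n (f ∘ (false ∷_))

  sumCube-cong : ∀ n {f g : Vec Bool n → ℤ} → (∀ v → f v ≡ g v) → sumCube n f ≡ sumCube n g
  sumCube-cong zero    f≗g = f≗g []
  sumCube-cong (suc n) f≗g = cong₂ _+_ (sumCube-cong n (f≗g ∘ (true ∷_))) (sumCube-cong n (f≗g ∘ (false ∷_)))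

  sumCube-additive : (h : ℤ → ℤ) → (∀ a b → h (a + b) ≡ h a + h b) →
                     ∀ n (f : Vec Bool n → ℤ) → sumCube n (h ∘ f) ≡ h (sumCube n f)
  sumCube-additive h h-+ zero    f = refl
  sumCube-additive h h-+ (suc n) f = trans
    (cong₂ _+_ (sumCube-additive h h-+ n (f ∘ (true ∷_))) (sumCube-additive h h-+ n (f ∘ (false ∷_))))
    (sym (h-+ _ _))

  sumCube-*ˡ : ∀ n c (f : Vec Bool n → ℤ) → sumCube n (λ v → c * f v) ≡ c * sumCube n f
  sumCube-*ˡ n c = sumCube-additive (c *_) (*-distribˡ-+ c) n

  sumCube-interchange : (_∙_ : ℤ → ℤ → ℤ) → (∀ a b c d → (a + b) ∙ (c + d) ≡ (a ∙ c) + (b ∙ d)) →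
                        ∀ n (f g : Vec Bool n → ℤ) → sumCube n (λ v → f v ∙ g v) ≡ sumCube n f ∙ sumCube n g
  sumCube-interchange _∙_ interchange zero    f g = refl
  sumCube-interchange _∙_ interchange (suc n) f g = trans
    (cong₂ _+_ (sumCube-interchange _∙_ interchange n (f ∘ (true ∷_)) (g ∘ (true ∷_)))
               (sumCube-interchange _∙_ interchange n (f ∘ (false ∷_)) (g ∘ (false ∷_))))
    (sym (interchange _ _ _ _))

  sumCube-+ : ∀ n (f g : Vec Bool n → ℤ) → sumCube n (λ v → f v + g v) ≡ sumCube n f + sumCube n g
  sumCube-+ = sumCube-interchange _+_ solve-∀

  sumCube-- : ∀ n (f g : Vec Bool n → ℤ) → sumCube n (λ v → f v - g v) ≡ sumCube n f - sumCube n g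
  sumCube-- = sumCube-interchange _-_ solve-∀

  sumCube-zero : ∀ n {f : Vec Bool n → ℤ} → (∀ v → f v ≡ 0ℤ) → sumCube n f ≡ 0ℤ
  sumCube-zero n f≗0 = trans (sumCube-cong n f≗0) (sumCube-*ˡ n 0ℤ λ _ → 0ℤ)

  sumCube-swap : ∀ n m (F : Vec Bool n → Vec Bool m → ℤ) →
                 sumCube n (λ v → sumCube m (F v)) ≡ sumCube m (λ w → sumCube n (λ v → F v w))
  sumCube-swap zero    m F = refl
  sumCube-swap (suc n) m F = trans
    (cong₂ _+_ (sumCube-swap n m (F ∘ (true ∷_))) (sumCube-swap n m (F ∘ (false ∷_))))
    (sym (sumCube-+ m _ _))

  sumCube-insertAt : ∀ n (i : Fin (suc n)) (g : Vec Bool (suc n) → ℤ) →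
                     sumCube (suc n) g ≡ sumCube n (λ v → g (insertAt v i true)) + sumCube n (λ v → g (insertAt v i false))
  sumCube-insertAt n       Fin.zero    g = refl
  sumCube-insertAt (suc n) (Fin.suc i) g = trans
    (cong₂ _+_ (sumCube-insertAt n i (g ∘ (true ∷_))) (sumCube-insertAt n i (g ∘ (false ∷_))))
    (middle-swap (sumCube n (λ v → g (true ∷ insertAt v i true))) (sumCube n (λ v → g (true ∷ insertAt v i false)))
                 (sumCube n (λ v → g (false ∷ insertAt v i true))) (sumCube n (λ v → g (false ∷ insertAt v i false))))
    where
    middle-swap : ∀ a b c d → (a + b) + (c + d) ≡ (a + c) + (b + d)
    middle-swap = solve-∀

  ∣-sumCube : ∀ {m} n (f : Vec Bool n → ℤ) → (∀ v → m ∣ f v) → m ∣ sumCube n f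
  ∣-sumCube zero    f m∣f = m∣f []
  ∣-sumCube (suc n) f m∣f =
    ∣m∣n⇒∣m+n (∣-sumCube n (f ∘ (true ∷_)) (m∣f ∘ (true ∷_))) (∣-sumCube n (f ∘ (false ∷_)) (m∣f ∘ (false ∷_)))

  sumCube-cong-mod : ∀ {m} n {f g : Vec Bool n → ℤ} → (∀ v → f v ≡ g v mod m) → sumCube n f ≡ sumCube n g mod m
  sumCube-cong-mod {m} n {f} {g} f≡g = congruent (subst (m ∣_) (sumCube-- n f g) (∣-sumCube n _ (m∣a-b ∘ f≡g)))

  weight-insertAt : ∀ {n} (v : Vec Bool n) i b → weight (insertAt v i b) ≡ weight (b ∷ v)
  weight-insertAt v           Fin.zero    b     = refl
  weight-insertAt (true ∷ v)  (Fin.suc i) true  = cong suc (weight-insertAt v i true)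
  weight-insertAt (true ∷ v)  (Fin.suc i) false = cong suc (weight-insertAt v i false)
  weight-insertAt (false ∷ v) (Fin.suc i) true  = weight-insertAt v i true
  weight-insertAt (false ∷ v) (Fin.suc i) false = weight-insertAt v i false

  monomial-swap : ∀ {n} s t b y (T x : Vec Bool n) → monomial (s ∷ t ∷ T) (b ∷ y ∷ x) ≡ monomial (t ∷ s ∷ T) (y ∷ b ∷ x)
  monomial-swap false true  b true  T x = refl
  monomial-swap false true  b false T x = refl
  monomial-swap false false b y     T x = refl
  monomial-swap true  t     false y T x with t | y
  ... | true  | true  = refl
  ... | true  | false = refl
  ... | false | _     = refl
  monomial-swap true  t     true  y T x with t | y
  ... | true  | true  = refl
  ... | true  | false = refl
  ... | false | _     = refl

  monomial-insertAt : ∀ {n} (T x : Vec Bool n) i s b → monomial (insertAt T i s) (insertAt x i b) ≡ monomial (s ∷ T) (b ∷ x)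
  monomial-insertAt T           x           Fin.zero    s b = refl
  monomial-insertAt (true ∷ T)  (true ∷ x)  (Fin.suc i) s b = trans (monomial-insertAt T x i s b) (sym (monomial-swap s true b true T x))
  monomial-insertAt (true ∷ T)  (false ∷ x) (Fin.suc i) s b = sym (monomial-swap s true b false T x)
  monomial-insertAt (false ∷ T) (y ∷ x)     (Fin.suc i) s b = trans (monomial-insertAt T x i s b) (sym (monomial-swap s false b y T x))

  monomial-cases : ∀ {n} (S x : Vec Bool n) → monomial S x ≡ 0 ⊎ (monomial S x ≡ 1 × weight S ℕ.≤ weight x)
  monomial-cases []          []          = inj₂ (refl , z≤n)
  monomial-cases (true ∷ S)  (false ∷ x) = inj₁ refl
  monomial-cases (true ∷ S)  (true ∷ x)  with monomial-cases S x
  ... | inj₁ ≡0          = inj₁ ≡0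
  ... | inj₂ (≡1 , S≤x)  = inj₂ (≡1 , s≤s S≤x)
  monomial-cases (false ∷ S) (true ∷ x)  with monomial-cases S x
  ... | inj₁ ≡0          = inj₁ ≡0
  ... | inj₂ (≡1 , S≤x)  = inj₂ (≡1 , ℕ.m≤n⇒m≤1+n S≤x)
  monomial-cases (false ∷ S) (false ∷ x) = monomial-cases S x

  monomial-∅ : ∀ {n} (x : Vec Bool n) → monomial (replicate n false) x ≡ 1
  monomial-∅ []      = refl
  monomial-∅ (_ ∷ x) = monomial-∅ x

  weight-∅ : ∀ n → weight (replicate n false) ≡ 0
  weight-∅ zero    = refl
  weight-∅ (suc n) = weight-∅ n

  weight≤length : ∀ {n} (v : Vec Bool n) → weight v ℕ.≤ n
  weight≤length []          = z≤n
  weight≤length (true ∷ v)  = s≤s (weight≤length v)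
  weight≤length (false ∷ v) = ℕ.m≤n⇒m≤1+n (weight≤length v)

  initialSegment : (n d : ℕ) → Vec Bool n
  initialSegment zero    _       = []
  initialSegment (suc n) zero    = false ∷ initialSegment n zero
  initialSegment (suc n) (suc d) = true ∷ initialSegment n d

  weight-initialSegment : ∀ {n d} → d ℕ.≤ n → weight (initialSegment n d) ≡ d
  weight-initialSegment {zero}  z≤n       = refl
  weight-initialSegment {suc n} z≤n       = weight-initialSegment {n} z≤n
  weight-initialSegment {suc n} (s≤s d≤n) = cong suc (weight-initialSegment d≤n)

  kronecker : ℕ → ℕ → ℤ
  kronecker i j = if does (i ℕ.≟ j) then 1ℤ else 0ℤ

  kronecker-refl : ∀ i → kronecker i i ≡ 1ℤ
  kronecker-refl i rewrite dec-true (i ℕ.≟ i) refl = refl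

  kronecker-≢ : ∀ {i j} → i ≢ j → kronecker i j ≡ 0ℤ
  kronecker-≢ {i} {j} i≢j rewrite dec-false (i ℕ.≟ j) i≢j = refl

  -- Σ_T [|T| = |S| + r] [S ⊆ T] [T ⊆ x], which counts the (|S| + r)-sets between S and x.
  supersetSum : ∀ {n} → Vec Bool n → Vec Bool n → ℕ → ℤ
  supersetSum {n} S x r = sumCube n (λ T → kronecker (weight T) (weight S ℕ.+ r) * (+ monomial S T * + monomial T x))

  supersetSum≡binomial : ∀ {n} (S x : Vec Bool n) r → supersetSum S x r ≡ + ((weight x ∸ weight S) C r) * + monomial S x
  supersetSum≡binomial []          []          zero    = refl
  supersetSum≡binomial []          []          (suc r) = refl
  supersetSum≡binomial {suc n} (true ∷ S)  (true ∷ x)  r = begin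
    supersetSum S x r + sumCube n (λ T → kronecker (weight T) (suc (weight S ℕ.+ r)) * 0ℤ)
      ≡⟨ cong (_+_ (supersetSum S x r)) (sumCube-zero n λ T → *-zeroʳ (kronecker (weight T) (suc (weight S ℕ.+ r)))) ⟩
    supersetSum S x r + 0ℤ                          ≡⟨ +-identityʳ _ ⟩
    supersetSum S x r                               ≡⟨ supersetSum≡binomial S x r ⟩
    + ((weight x ∸ weight S) C r) * + monomial S x  ∎
    where open ≡-Reasoning
  supersetSum≡binomial {suc n} (true ∷ S)  (false ∷ x) r = begin
    sumCube n (λ T → kronecker (suc (weight T)) (suc (weight S ℕ.+ r)) * (+ monomial S T * 0ℤ))
      + sumCube n (λ T → kronecker (weight T) (suc (weight S ℕ.+ r)) * 0ℤ)
      ≡⟨ cong₂ _+_ (sumCube-zero n λ T → a*[b*0]≡0 (kronecker (suc (weight T)) (suc (weight S ℕ.+ r))) (+ monomial S T))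
                   (sumCube-zero n λ T → *-zeroʳ (kronecker (weight T) (suc (weight S ℕ.+ r)))) ⟩
    0ℤ                                              ≡⟨ *-zeroʳ (+ ((weight x ∸ suc (weight S)) C r)) ⟨
    + ((weight x ∸ suc (weight S)) C r) * 0ℤ        ∎
    where
    open ≡-Reasoning
    a*[b*0]≡0 : ∀ a b → a * (b * 0ℤ) ≡ 0ℤ
    a*[b*0]≡0 = solve-∀
  supersetSum≡binomial {suc n} (false ∷ S) (false ∷ x) r = begin
    sumCube n (λ T → kronecker (suc (weight T)) (weight S ℕ.+ r) * (+ monomial S T * 0ℤ)) + supersetSum S x r
      ≡⟨ cong (_+ supersetSum S x r) (sumCube-zero n λ T → a*[b*0]≡0 (kronecker (suc (weight T)) (weight S ℕ.+ r)) (+ monomial S T)) ⟩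
    0ℤ + supersetSum S x r                          ≡⟨ +-identityˡ _ ⟩
    supersetSum S x r                               ≡⟨ supersetSum≡binomial S x r ⟩
    + ((weight x ∸ weight S) C r) * + monomial S x  ∎
    where
    open ≡-Reasoning
    a*[b*0]≡0 : ∀ a b → a * (b * 0ℤ) ≡ 0ℤ
    a*[b*0]≡0 = solve-∀
  supersetSum≡binomial {suc n} (false ∷ S) (true ∷ x)  zero = begin
    sumCube n (λ T → kronecker (suc (weight T)) (weight S ℕ.+ 0) * (+ monomial S T * + monomial T x)) + supersetSum S x 0
      ≡⟨ cong (_+ supersetSum S x 0) (sumCube-zero n too-heavy) ⟩
    0ℤ + supersetSum S x 0                          ≡⟨ +-identityˡ _ ⟩
    supersetSum S x 0                               ≡⟨ supersetSum≡binomial S x 0 ⟩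
    + 1 * + monomial S x                            ∎
    where
    open ≡-Reasoning
    too-heavy : ∀ T → kronecker (suc (weight T)) (weight S ℕ.+ 0) * (+ monomial S T * + monomial T x) ≡ 0ℤ
    too-heavy T with monomial-cases S T
    ... | inj₁ ≡0 rewrite ≡0 = *-zeroʳ (kronecker (suc (weight T)) (weight S ℕ.+ 0))
    ... | inj₂ (≡1 , S≤T) rewrite kronecker-≢ {suc (weight T)} {weight S ℕ.+ 0}
            (λ eq → ℕ.<⇒≢ (s≤s (ℕ.≤-trans (ℕ.≤-reflexive (ℕ.+-identityʳ (weight S))) S≤T)) (sym eq)) = refl
  supersetSum≡binomial {suc n} (false ∷ S) (true ∷ x)  (suc r) = begin
    sumCube n (λ T → kronecker (suc (weight T)) (weight S ℕ.+ suc r) * (+ monomial S T * + monomial T x)) + supersetSum S x (suc r)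
      ≡⟨ cong (λ w → sumCube n (λ T → kronecker (suc (weight T)) w * (+ monomial S T * + monomial T x)) + supersetSum S x (suc r))
              (ℕ.+-suc (weight S) r) ⟩
    supersetSum S x r + supersetSum S x (suc r)
      ≡⟨ cong₂ _+_ (supersetSum≡binomial S x r) (supersetSum≡binomial S x (suc r)) ⟩
    + (a C r) * + monomial S x + + (a C suc r) * + monomial S x
      ≡⟨ *-distribʳ-+ (+ monomial S x) (+ (a C r)) (+ (a C suc r)) ⟨
    + (a C r ℕ.+ a C suc r) * + monomial S x
      ≡⟨ pascal ⟩
    + ((suc (weight x) ∸ weight S) C suc r) * + monomial S x ∎
    where
    open ≡-Reasoning
    a = weight x ∸ weight S
    pascal : + (a C r ℕ.+ a C suc r) * + monomial S x ≡ + ((suc (weight x) ∸ weight S) C suc r) * + monomial S x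
    pascal with monomial-cases S x
    ... | inj₁ ≡0 rewrite ≡0 = trans (*-zeroʳ (+ (a C r ℕ.+ a C suc r))) (sym (*-zeroʳ (+ ((suc (weight x) ∸ weight S) C suc r))))
    ... | inj₂ (_ , S≤x) rewrite ℕ.+-∸-assoc 1 S≤x = cong (λ c → + c * + monomial S x) (nCk+nC[k+1]≡[n+1]C[k+1] a r)

  sumCube-subsetsOfSize : ∀ n (x : Vec Bool n) d → sumCube n (λ T → kronecker (weight T) d * + monomial T x) ≡ + (weight x C d)
  sumCube-subsetsOfSize n x d = begin
    sumCube n (λ T → kronecker (weight T) d * + monomial T x)
      ≡⟨ sumCube-cong n (λ T → cong (kronecker (weight T) d *_) (*-identityˡ (+ monomial T x))) ⟨
    sumCube n (λ T → kronecker (weight T) (0 ℕ.+ d) * (+ 1 * + monomial T x))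
      ≡⟨ sumCube-cong n (λ T → cong₂ (λ w μ → kronecker (weight T) (w ℕ.+ d) * (+ μ * + monomial T x)) (weight-∅ n) (monomial-∅ T)) ⟨
    supersetSum ∅ x d
      ≡⟨ supersetSum≡binomial ∅ x d ⟩
    + ((weight x ∸ weight ∅) C d) * + monomial ∅ x
      ≡⟨ cong₂ (λ w μ → + ((weight x ∸ w) C d) * + μ) (weight-∅ n) (monomial-∅ x) ⟩
    + (weight x C d) * 1ℤ
      ≡⟨ *-identityʳ _ ⟩
    + (weight x C d) ∎
    where
    open ≡-Reasoning
    ∅ = replicate n false

  evalℤ : ∀ {n} → (Vec Bool n → ℤ) → Vec Bool n → ℤ
  evalℤ {n} c x = sumCube n (λ T → c T * + monomial T x)

  evalℤ-- : ∀ {n} (f g : Vec Bool n → ℤ) x → evalℤ (λ T → f T - g T) x ≡ evalℤ f x - evalℤ g x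
  evalℤ-- {n} f g x = trans (sumCube-cong n λ T → *-distribʳ-- (+ monomial T x) (f T) (g T)) (sumCube-- n _ _)
    where
    *-distribʳ-- : ∀ μ u v → (u - v) * μ ≡ u * μ - v * μ
    *-distribʳ-- = solve-∀

  Homogeneous : ∀ {n} → ℕ → (Vec Bool n → ℤ) → Set
  Homogeneous d c = ∀ T → weight T ≢ d → c T ≡ 0ℤ

  monomial-∷-cong : ∀ {n m} s b {T x : Vec Bool n} {T′ x′ : Vec Bool m} →
                    monomial T x ≡ monomial T′ x′ → monomial (s ∷ T) (b ∷ x) ≡ monomial (s ∷ T′) (b ∷ x′)
  monomial-∷-cong true  true  eq = eq
  monomial-∷-cong true  false eq = refl
  monomial-∷-cong false b     eq = eq

  module _ {M : ℕ} (i : Fin (suc (suc M))) (j : Fin (suc M)) where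

    ins₂ : Bool → Bool → Vec Bool M → Vec Bool (suc (suc M))
    ins₂ s t V = insertAt (insertAt V j t) i s

    weight-ins₂ : ∀ s t V → weight (ins₂ s t V) ≡ weight (s ∷ t ∷ V)
    weight-ins₂ true  t V = trans (weight-insertAt _ i true) (cong suc (weight-insertAt V j t))
    weight-ins₂ false t V = trans (weight-insertAt _ i false) (weight-insertAt V j t)

    monomial-ins₂ : ∀ s t b y (V x : Vec Bool M) → monomial (ins₂ s t V) (ins₂ b y x) ≡ monomial (s ∷ t ∷ V) (b ∷ y ∷ x)
    monomial-ins₂ s t b y V x = trans (monomial-insertAt _ _ i s b) (monomial-∷-cong s b (monomial-insertAt V x j t y))

    sumCube-ins₂ : (h : Vec Bool (suc (suc M)) → ℤ) →
      sumCube (suc (suc M)) h ≡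
        sumCube M (λ V → (h (ins₂ true true V) + h (ins₂ true false V)) + (h (ins₂ false true V) + h (ins₂ false false V)))
    sumCube-ins₂ h = begin
      sumCube (suc (suc M)) h
        ≡⟨ sumCube-insertAt (suc M) i h ⟩
      sumCube (suc M) (λ W → h (insertAt W i true)) + sumCube (suc M) (λ W → h (insertAt W i false))
        ≡⟨ cong₂ _+_ (sumCube-insertAt M j (λ W → h (insertAt W i true))) (sumCube-insertAt M j (λ W → h (insertAt W i false))) ⟩
      (sumCube M (h ∘ ins₂ true true) + sumCube M (h ∘ ins₂ true false)) + (sumCube M (h ∘ ins₂ false true) + sumCube M (h ∘ ins₂ false false))
        ≡⟨ cong₂ _+_ (sumCube-+ M _ _) (sumCube-+ M _ _) ⟨
      sumCube M (λ V → h (ins₂ true true V) + h (ins₂ true false V)) + sumCube M (λ V → h (ins₂ false true V) + h (ins₂ false false V))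
        ≡⟨ sumCube-+ M _ _ ⟨
      sumCube M (λ V → (h (ins₂ true true V) + h (ins₂ true false V)) + (h (ins₂ false true V) + h (ins₂ false false V))) ∎
      where open ≡-Reasoning

    evalℤ-exchange : (δ : Vec Bool (suc (suc M)) → ℤ) (y : Vec Bool M) →
      evalℤ (λ V → δ (ins₂ true false V) - δ (ins₂ false true V)) y ≡ evalℤ δ (ins₂ true false y) - evalℤ δ (ins₂ false true y)
    evalℤ-exchange δ y = sym (begin
      evalℤ δ (ins₂ true false y) - evalℤ δ (ins₂ false true y)
        ≡⟨ cong₂ _-_ (sumCube-ins₂ (term true false)) (sumCube-ins₂ (term false true)) ⟩
      sumCube M (quadruple (term true false)) - sumCube M (quadruple (term false true))
        ≡⟨ sumCube-- M _ _ ⟨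
      sumCube M (λ V → quadruple (term true false) V - quadruple (term false true) V)
        ≡⟨ sumCube-cong M pointwise ⟩
      evalℤ (λ V → δ (ins₂ true false V) - δ (ins₂ false true V)) y ∎)
      where
      open ≡-Reasoning
      term : Bool → Bool → Vec Bool (suc (suc M)) → ℤ
      term b c T = δ T * + monomial T (ins₂ b c y)
      quadruple : (Vec Bool (suc (suc M)) → ℤ) → Vec Bool M → ℤ
      quadruple h V = (h (ins₂ true true V) + h (ins₂ true false V)) + (h (ins₂ false true V) + h (ins₂ false false V))
      collect : ∀ a b c d m → ((a * 0ℤ + b * m) + (c * 0ℤ + d * m)) - ((a * 0ℤ + b * 0ℤ) + (c * m + d * m)) ≡ (b - c) * m
      collect = solve-∀
      pointwise : ∀ V → quadruple (term true false) V - quadruple (term false true) V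
                      ≡ (δ (ins₂ true false V) - δ (ins₂ false true V)) * + monomial V y
      pointwise V
        rewrite monomial-ins₂ true true true false V y | monomial-ins₂ true false true false V y
              | monomial-ins₂ false true true false V y | monomial-ins₂ false false true false V y
              | monomial-ins₂ true true false true V y | monomial-ins₂ true false false true V y
              | monomial-ins₂ false true false true V y | monomial-ins₂ false false false true V y
        = collect (δ (ins₂ true true V)) (δ (ins₂ true false V)) (δ (ins₂ false true V)) (δ (ins₂ false false V)) (+ monomial V y)

  InvertibleMod : ℤ → ℤ → Set
  InvertibleMod m b = ∃[ u ] u * b ≡ 1ℤ mod m

  invertible⇒cancel : ∀ {m b c} → InvertibleMod m b → m ∣ c * b → m ∣ c
  invertible⇒cancel {m} {b} {c} (u , congruent ub≡1) m∣cb =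
    subst (m ∣_) (cancel u b c) (∣m∣n⇒∣m-n (∣n⇒∣m*n u m∣cb) (∣n⇒∣m*n c ub≡1))
    where
    cancel : ∀ u b c → u * (c * b) - c * (u * b - 1ℤ) ≡ c
    cancel = solve-∀

  BinomialsInvertible : ℤ → ℕ → ℕ → Set
  BinomialsInvertible m k d = ∀ j → InvertibleMod m (+ ((k ∸ j) C (d ∸ j)))

  module _ (m : ℤ) where

    SwapInvariant : ∀ N → ℕ → (Vec Bool N → ℤ) → Set
    SwapInvariant (suc (suc M)) d g = ∀ i j V → suc (weight V) ≡ d → g (ins₂ i j true false V) ≡ g (ins₂ i j false true V) mod m
    SwapInvariant _             _ _ = ⊤

    swapInvariant-false : ∀ N {d} g → SwapInvariant (suc N) d g → SwapInvariant N d (g ∘ (false ∷_))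
    swapInvariant-false zero          g _   = tt
    swapInvariant-false (suc zero)    g _   = tt
    swapInvariant-false (suc (suc M)) g inv i j V = inv (Fin.suc i) (Fin.suc j) (false ∷ V)

    swapInvariant-true : ∀ N {d} g → SwapInvariant (suc N) (suc d) g → SwapInvariant N d (g ∘ (true ∷_))
    swapInvariant-true zero          g _   = tt
    swapInvariant-true (suc zero)    g _   = tt
    swapInvariant-true (suc (suc M)) g inv i j V w≡d = inv (Fin.suc i) (Fin.suc j) (true ∷ V) (cong suc w≡d)

    -- Any weight-d string is reached from the initial segment by exchanges of a 1 and a 0.
    swapInvariant⇒constant : ∀ N d g → SwapInvariant N d g → ∀ T → weight T ≡ d → g T ≡ g (initialSegment N d) mod m
    swapInvariant⇒constant zero          d       g inv []          _   = ≡-mod-refl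
    swapInvariant⇒constant (suc N)       zero    g inv (true ∷ T)  ()
    swapInvariant⇒constant (suc N)       zero    g inv (false ∷ T) w≡0 =
      swapInvariant⇒constant N zero (g ∘ (false ∷_)) (swapInvariant-false N g inv) T w≡0
    swapInvariant⇒constant (suc N)       (suc d) g inv (true ∷ T)  w≡d =
      swapInvariant⇒constant N d (g ∘ (true ∷_)) (swapInvariant-true N g inv) T (ℕ.suc-injective w≡d)
    swapInvariant⇒constant (suc zero)    (suc d) g inv (false ∷ []) ()
    swapInvariant⇒constant (suc (suc M)) (suc d) g inv (false ∷ T) w≡d = ≡-mod-trans
      (swapInvariant⇒constant (suc M) (suc d) (g ∘ (false ∷_)) (swapInvariant-false (suc M) g inv) T w≡d)
      (≡-mod-trans (≡-mod-sym (inv Fin.zero Fin.zero (initialSegment M d) (cong suc (weight-initialSegment d≤M))))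
        (swapInvariant⇒constant (suc M) d (g ∘ (true ∷_)) (swapInvariant-true (suc M) g inv)
          (false ∷ initialSegment M d) (weight-initialSegment d≤M)))
      where
      d≤M : d ℕ.≤ M
      d≤M = ℕ.≤-pred (subst (ℕ._≤ suc M) w≡d (weight≤length T))

    evalℤ-constant : ∀ {n d c} (δ : Vec Bool n → ℤ) → Homogeneous d δ → (∀ T → weight T ≡ d → δ T ≡ c mod m) →
                     ∀ x → evalℤ δ x ≡ c * + (weight x C d) mod m
    evalℤ-constant {n} {d} {c} δ hom δ≡c x = begin
      evalℤ δ x                                                       ≈⟨ sumCube-cong-mod n pointwise ⟩
      sumCube n (λ T → c * (kronecker (weight T) d * + monomial T x)) ≡⟨ sumCube-*ˡ n c _ ⟩
      c * sumCube n (λ T → kronecker (weight T) d * + monomial T x)    ≡⟨ cong (c *_) (sumCube-subsetsOfSize n x d) ⟩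
      c * + (weight x C d)                                             ∎
      where
      open ≡-mod-Reasoning m
      pointwise : ∀ T → δ T * + monomial T x ≡ c * (kronecker (weight T) d * + monomial T x) mod m
      pointwise T with weight T ℕ.≟ d
      ... | yes w≡d rewrite w≡d | kronecker-refl d | *-identityˡ (+ monomial T x) = *-congʳ-mod (+ monomial T x) (δ≡c T w≡d)
      ... | no  w≢d rewrite kronecker-≢ w≢d | hom T w≢d = ≡⇒≡-mod (sym (*-zeroʳ c))

    VanishesOnSlice : ∀ {N} → ℕ → (Vec Bool N → ℤ) → Set
    VanishesOnSlice k δ = ∀ x → weight x ≡ k → m ∣ evalℤ δ x

    homogeneous-vanishing : ∀ d {N k} → BinomialsInvertible m k d → d ℕ.≤ k → k ℕ.+ d ℕ.≤ N → (δ : Vec Bool N → ℤ) →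
      Homogeneous d δ → VanishesOnSlice k δ → ∀ T → weight T ≡ d → m ∣ δ T

    -- T ↦ δ (T with 1 at i, 0 at j) − δ (T with 0 at i, 1 at j) is homogeneous of degree d − 1 and
    -- vanishes on the (k − 1)-slice of the remaining n − 2 coordinates.
    vanishing⇒swapInvariant : ∀ d {N k} → BinomialsInvertible m k d → d ℕ.≤ k → k ℕ.+ d ℕ.≤ N → (δ : Vec Bool N → ℤ) →
      Homogeneous d δ → VanishesOnSlice k δ → SwapInvariant N d δ
    vanishing⇒swapInvariant d       {zero}                  _ _ _ _ _ _ = tt
    vanishing⇒swapInvariant d       {suc zero}              _ _ _ _ _ _ = tt
    vanishing⇒swapInvariant zero    {suc (suc M)}           _ _ _ _ _ _ i j V ()
    vanishing⇒swapInvariant (suc d) {suc (suc M)} {suc k} inv (s≤s d≤k) k+d≤N δ hom van i j V w≡d =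
      congruent (homogeneous-vanishing d (inv ∘ suc) d≤k k+d≤M δ′ hom′ van′ V (ℕ.suc-injective w≡d))
      where
      δ′ : Vec Bool M → ℤ
      δ′ W = δ (ins₂ i j true false W) - δ (ins₂ i j false true W)
      k+d≤M : k ℕ.+ d ℕ.≤ M
      k+d≤M = ℕ.≤-pred (ℕ.≤-pred (subst (ℕ._≤ suc (suc M)) (ℕ.+-suc (suc k) d) k+d≤N))
      hom′ : Homogeneous d δ′
      hom′ W w≢d rewrite hom (ins₂ i j true false W) (w≢d ∘ ℕ.suc-injective ∘ trans (sym (weight-ins₂ i j true false W)))
                       | hom (ins₂ i j false true W) (w≢d ∘ ℕ.suc-injective ∘ trans (sym (weight-ins₂ i j false true W))) = refl
      van′ : VanishesOnSlice k δ′
      van′ y w≡k = subst (m ∣_) (sym (evalℤ-exchange i j δ y)) (∣m∣n⇒∣m-n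
        (van (ins₂ i j true false y) (trans (weight-ins₂ i j true false y) (cong suc w≡k)))
        (van (ins₂ i j false true y) (trans (weight-ins₂ i j false true y) (cong suc w≡k))))

    homogeneous-vanishing d {N} {k} inv d≤k k+d≤N δ hom van T w≡d = ≡-mod-∣ (constant T w≡d) m∣δ₀
      where
      constant = swapInvariant⇒constant N d δ (vanishing⇒swapInvariant d inv d≤k k+d≤N δ hom van)
      x₀ = initialSegment N k
      weight-x₀ : weight x₀ ≡ k
      weight-x₀ = weight-initialSegment (ℕ.≤-trans (ℕ.m≤m+n k d) k+d≤N)
      evaluation : evalℤ δ x₀ ≡ δ (initialSegment N d) * + (k C d) mod m
      evaluation = subst (λ w → evalℤ δ x₀ ≡ δ (initialSegment N d) * + (w C d) mod m) weight-x₀ (evalℤ-constant δ hom constant x₀)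
      m∣δ₀ : m ∣ δ (initialSegment N d)
      m∣δ₀ = invertible⇒cancel (inv 0) (≡-mod-∣ (≡-mod-sym evaluation) (van x₀ weight-x₀))

    homogeneous-exists : ∀ {n k d} → BinomialsInvertible m k d → (c : Vec Bool n → ℤ) → (∀ S → d ℕ.< weight S → c S ≡ 0ℤ) →
      Σ[ a ∈ (Vec Bool n → ℤ) ] Homogeneous d a × (∀ x → weight x ≡ k → evalℤ a x ≡ evalℤ c x mod m)
    homogeneous-exists {n} {k} {d} inv c deg = a , homogeneous , represents
      where
      u : ℕ → ℤ
      u j = proj₁ (inv j)
      a : Vec Bool n → ℤ
      a T = kronecker (weight T) d * sumCube n (λ S → c S * u (weight S) * + monomial S T)
      homogeneous : Homogeneous d a
      homogeneous T w≢d rewrite kronecker-≢ w≢d = refl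
      supersets : Vec Bool n → Vec Bool n → ℤ
      supersets x S = sumCube n (λ T → kronecker (weight T) d * (+ monomial S T * + monomial T x))
      per-subset : ∀ x → weight x ≡ k → ∀ S → c S * u (weight S) * supersets x S ≡ c S * + monomial S x mod m
      per-subset x w≡k S with weight S ℕ.≤? d
      ... | no  S>d rewrite deg S (ℕ.≰⇒> S>d) = ≡-mod-refl
      ... | yes S≤d = begin
        c S * u (weight S) * supersets x S    ≡⟨ cong (c S * u (weight S) *_) count ⟩
        c S * u (weight S) * (binomial * μ)   ≡⟨ regroup (c S) (u (weight S)) binomial μ ⟩
        u (weight S) * binomial * (c S * μ)   ≈⟨ *-congʳ-mod (c S * μ) (proj₂ (inv (weight S))) ⟩
        1ℤ * (c S * μ)                        ≡⟨ *-identityˡ (c S * μ) ⟩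
        c S * μ                               ∎
        where
        open ≡-mod-Reasoning m
        binomial = + ((k ∸ weight S) C (d ∸ weight S))
        μ = + monomial S x
        count : supersets x S ≡ binomial * μ
        count = trans (sumCube-cong n λ T → cong (λ w → kronecker (weight T) w * (+ monomial S T * + monomial T x)) (sym (ℕ.m+[n∸m]≡n S≤d)))
                  (trans (supersetSum≡binomial S x (d ∸ weight S)) (cong (λ w → + ((w ∸ weight S) C (d ∸ weight S)) * μ) w≡k))
        regroup : ∀ c u b μ → c * u * (b * μ) ≡ u * b * (c * μ)
        regroup = solve-∀
      expand : ∀ x T → a T * + monomial T x ≡ sumCube n (λ S → c S * u (weight S) * (kronecker (weight T) d * (+ monomial S T * + monomial T x)))
      expand x T = begin
        kronecker (weight T) d * sumCube n (λ S → c S * u (weight S) * + monomial S T) * + monomial T x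
          ≡⟨ regroup (kronecker (weight T) d) _ (+ monomial T x) ⟩
        kronecker (weight T) d * + monomial T x * sumCube n (λ S → c S * u (weight S) * + monomial S T)
          ≡⟨ sumCube-*ˡ n (kronecker (weight T) d * + monomial T x) (λ S → c S * u (weight S) * + monomial S T) ⟨
        sumCube n (λ S → kronecker (weight T) d * + monomial T x * (c S * u (weight S) * + monomial S T))
          ≡⟨ sumCube-cong n (λ S → regroup′ (kronecker (weight T) d) (+ monomial T x) (c S * u (weight S)) (+ monomial S T)) ⟩
        sumCube n (λ S → c S * u (weight S) * (kronecker (weight T) d * (+ monomial S T * + monomial T x))) ∎
        where
        open ≡-Reasoning
        regroup : ∀ k σ μ → k * σ * μ ≡ k * μ * σ
        regroup = solve-∀
        regroup′ : ∀ k μ g ν → k * μ * (g * ν) ≡ g * (k * (ν * μ))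
        regroup′ = solve-∀
      represents : ∀ x → weight x ≡ k → evalℤ a x ≡ evalℤ c x mod m
      represents x w≡k = begin
        evalℤ a x
          ≡⟨ sumCube-cong n (expand x) ⟩
        sumCube n (λ T → sumCube n (λ S → c S * u (weight S) * (kronecker (weight T) d * (+ monomial S T * + monomial T x))))
          ≡⟨ sumCube-swap n n _ ⟩
        sumCube n (λ S → sumCube n (λ T → c S * u (weight S) * (kronecker (weight T) d * (+ monomial S T * + monomial T x))))
          ≡⟨ sumCube-cong n (λ S → sumCube-*ˡ n (c S * u (weight S)) _) ⟩
        sumCube n (λ S → c S * u (weight S) * supersets x S)
          ≈⟨ sumCube-cong-mod n (per-subset x w≡k) ⟩
        evalℤ c x ∎
        where open ≡-mod-Reasoning m

module ResidueRepresentation where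
  open Binomials
  open SliceRepresentation
  open import Defs
  open import Data.Nat as ℕ using (ℕ; zero; suc; NonZero; _^_)
  import Data.Nat.Properties as ℕ
  open import Data.Nat.DivMod using (_%_; _/_; m≡m%n+[m/n]*n; [m+kn]%n≡m%n; m<n⇒m%n≡m)
  open import Data.Nat.Divisibility using (_∤_; ∣-trans; m∣m*n; ∣1⇒≡1)
  open import Data.Nat.Coprimality using (Coprime; coprime-factors; coprime-Bézout)
  open import Data.Nat.GCD using (module Bézout)
  open import Data.Nat.ListAction using (sum)
  open import Data.Nat.ListAction.Properties using (sum-++)
  open import Data.Nat.Primality using (Prime; prime⇒irreducible; prime⇒nonZero)
  open import Data.Integer using (ℤ; +_; -[1+_]; 0ℤ; 1ℤ; _+_; _*_; _-_; -_)
  open import Data.Integer.Properties using (pos-*; +-injective; neg-distribˡ-*)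
  open import Data.Integer.DivMod using (_%ℕ_; _/ℕ_; n%ℕd<d; a≡a%ℕn+[a/ℕn]*n)
  open import Data.Integer.Divisibility.Signed using (_∣_; divides)
  open import Data.Integer.Tactic.RingSolver using (solve-∀)
  open import Data.Bool using (Bool; true; false)
  open import Data.Vec as Vec using (Vec; _∷_)
  open import Data.List using ([]; _∷_; _++_; map)
  open import Data.List.Properties using (map-++; map-∘)
  open import Data.Fin using (Fin; toℕ; fromℕ<)
  open import Data.Fin.Properties using (toℕ-fromℕ<; toℕ-injective; toℕ<n)
  open import Data.Product using (Σ-syntax; _×_; _,_; proj₁; proj₂)
  open import Data.Sum using (inj₁; inj₂)
  open import Function using (_∘_)
  open import Relation.Nullary using (contradiction)
  open import Relation.Binary.PropositionalEquality

  module _ {p : ℕ} (prime : Prime p) where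

    p∤⇒coprime : ∀ {b} → p ∤ b → Coprime p b
    p∤⇒coprime p∤b (i∣p , i∣b) with prime⇒irreducible prime i∣p
    ... | inj₁ i≡1  = i≡1
    ... | inj₂ refl = contradiction i∣b p∤b

    p∤⇒coprime-^ : ∀ e {b} → p ∤ b → Coprime (p ^ e) b
    p∤⇒coprime-^ zero    p∤b (i∣1 , _)   = ∣1⇒≡1 i∣1
    p∤⇒coprime-^ (suc e) p∤b (i∣p^e+1 , i∣b) =
      p∤⇒coprime-^ e p∤b (coprime-factors (p∤⇒coprime p∤b) (i∣p^e+1 , ∣-trans i∣b (m∣m*n (p ^ e))) , i∣b)

    p∤⇒invertible : ∀ e {b} → p ∤ b → InvertibleMod (+ (p ^ e)) (+ b)
    p∤⇒invertible e {b} p∤b with coprime-Bézout (p∤⇒coprime-^ e p∤b)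
    ... | Bézout.+- x y 1+yb≡xq = - + y , congruent (divides (- + x) (from-+- (+ y) (+ b) (+ x) (+ (p ^ e)) (cast 1+yb≡xq)))
      where
      from-+- : ∀ y b x q → 1ℤ + y * b ≡ x * q → - y * b - 1ℤ ≡ - x * q
      from-+- y b x q eq = trans (negate y b) (trans (cong -_ eq) (neg-distribˡ-* x q))
        where
        negate : ∀ y b → - y * b - 1ℤ ≡ - (1ℤ + y * b)
        negate = solve-∀
      cast : 1 ℕ.+ y ℕ.* b ≡ x ℕ.* p ^ e → 1ℤ + + y * + b ≡ + x * + (p ^ e)
      cast eq = trans (cong (_+_ 1ℤ) (sym (pos-* y b))) (trans (cong +_ eq) (pos-* x (p ^ e)))
    ... | Bézout.-+ x y 1+xq≡yb = + y , congruent (divides (+ x) (from--+ (+ y) (+ b) (+ x) (+ (p ^ e)) (cast 1+xq≡yb)))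
      where
      from--+ : ∀ y b x q → 1ℤ + x * q ≡ y * b → y * b - 1ℤ ≡ x * q
      from--+ y b x q eq = trans (cong (_- 1ℤ) (sym eq)) (cancel x q)
        where
        cancel : ∀ x q → 1ℤ + x * q - 1ℤ ≡ x * q
        cancel = solve-∀
      cast : 1 ℕ.+ x ℕ.* p ^ e ≡ y ℕ.* b → 1ℤ + + x * + (p ^ e) ≡ + y * + b
      cast eq = trans (cong (_+_ 1ℤ) (sym (pos-* x (p ^ e)))) (trans (cong +_ eq) (pos-* y b))

    private instance
      p≢0 : NonZero p
      p≢0 = prime⇒nonZero prime

    good⇒binomialsInvertible : ∀ e {d k} → Good p d k → BinomialsInvertible (+ (p ^ e)) k d
    good⇒binomialsInvertible e good j = p∤⇒invertible e (good⇒p∤binomials prime good j)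

  sum-allVecs : ∀ n (h : Vec Bool n → ℕ) → + sum (map h (allVecs n)) ≡ sumCube n (+_ ∘ h)
  sum-allVecs zero    h = cong +_ (ℕ.+-identityʳ (h Vec.[]))
  sum-allVecs (suc n) h = begin
    + sum (map h (map (true ∷_) vs ++ map (false ∷_) vs))
      ≡⟨ cong (+_ ∘ sum) (map-++ h (map (true ∷_) vs) (map (false ∷_) vs)) ⟩
    + sum (map h (map (true ∷_) vs) ++ map h (map (false ∷_) vs))
      ≡⟨ cong +_ (sum-++ (map h (map (true ∷_) vs)) (map h (map (false ∷_) vs))) ⟩
    + sum (map h (map (true ∷_) vs)) + + sum (map h (map (false ∷_) vs))
      ≡⟨ cong₂ (λ xs ys → + sum xs + + sum ys) (map-∘ vs) (map-∘ vs) ⟨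
    + sum (map (h ∘ (true ∷_)) vs) + + sum (map (h ∘ (false ∷_)) vs)
      ≡⟨ cong₂ _+_ (sum-allVecs n (h ∘ (true ∷_))) (sum-allVecs n (h ∘ (false ∷_))) ⟩
    sumCube (suc n) (+_ ∘ h) ∎
    where
    open ≡-Reasoning
    vs = allVecs n

  module _ {q : ℕ} .{{_ : NonZero q}} where

    lift : ∀ {n} → (Vec Bool n → Fin q) → Vec Bool n → ℤ
    lift c T = + toℕ (c T)

    evalSum≡evalℤ : ∀ {n} (c : Vec Bool n → Fin q) x → + evalSum c x (allVecs n) ≡ evalℤ (lift c) x
    evalSum≡evalℤ {n} c x = begin
      + evalSum c x (allVecs n)                                  ≡⟨ cong +_ (evalSum≡sum (allVecs n)) ⟩
      + sum (map term (allVecs n))                               ≡⟨ sum-allVecs n term ⟩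
      sumCube n (λ T → + (toℕ (c T) ℕ.* monomial T x))           ≡⟨ sumCube-cong n (λ T → pos-* (toℕ (c T)) (monomial T x)) ⟩
      evalℤ (lift c) x                                           ∎
      where
      open ≡-Reasoning
      term : Vec Bool n → ℕ
      term T = toℕ (c T) ℕ.* monomial T x
      evalSum≡sum : ∀ Ts → evalSum c x Ts ≡ sum (map term Ts)
      evalSum≡sum []       = refl
      evalSum≡sum (T ∷ Ts) = cong (term T ℕ.+_) (evalSum≡sum Ts)

    %≡%⇒≡-mod : ∀ a b → a % q ≡ b % q → + a ≡ + b mod + q
    %≡%⇒≡-mod a b a%q≡b%q = congruent (divides (+ (a / q) - + (b / q)) (begin
      + a - + b
        ≡⟨ cong₂ _-_ (trans (split a) (cong (λ r → + r + + (a / q) * + q) a%q≡b%q)) (split b) ⟩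
      (+ (b % q) + + (a / q) * + q) - (+ (b % q) + + (b / q) * + q)
        ≡⟨ cancel (+ (b % q)) (+ (a / q)) (+ (b / q)) (+ q) ⟩
      (+ (a / q) - + (b / q)) * + q ∎))
      where
      open ≡-Reasoning
      split : ∀ n → + n ≡ + (n % q) + + (n / q) * + q
      split n = trans (cong +_ (m≡m%n+[m/n]*n n q)) (cong (_+_ (+ (n % q))) (pos-* (n / q) q))
      cancel : ∀ r x y q → (r + x * q) - (r + y * q) ≡ (x - y) * q
      cancel = solve-∀

    ≡-mod⇒%≡% : ∀ a b → + a ≡ + b mod + q → a % q ≡ b % q
    ≡-mod⇒%≡% a b (congruent (divides (+ w) a-b≡wq))        = multiple⇒%≡% a b w a-b≡wq
      where
      multiple⇒%≡% : ∀ a b w → + a - + b ≡ + w * + q → a % q ≡ b % q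
      multiple⇒%≡% a b w a-b≡wq = trans
        (cong (_% q) (+-injective (trans (shift (+ a) (+ b) (+ w * + q) a-b≡wq) (cong (_+_ (+ b)) (sym (pos-* w q))))))
        ([m+kn]%n≡m%n b w q)
        where
        shift : ∀ a b c → a - b ≡ c → a ≡ b + c
        shift a b c eq = trans (a≡b+[a-b] a b) (cong (_+_ b) eq)
          where
          a≡b+[a-b] : ∀ a b → a ≡ b + (a - b)
          a≡b+[a-b] = solve-∀
    ≡-mod⇒%≡% a b (congruent (divides -[1+ w ] a-b≡-[1+w]q)) = sym (≡-mod⇒%≡% b a (congruent (divides (+ suc w)
      (trans (swap (+ a) (+ b)) (trans (cong -_ a-b≡-[1+w]q) (neg-distribˡ-* -[1+ w ] (+ q)))))))
      where
      swap : ∀ a b → b - a ≡ - (a - b)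
      swap = solve-∀

    toℕ-eval : ∀ {n} (c : Vec Bool n → Fin q) x → toℕ (eval c x) ≡ evalSum c x (allVecs n) % q
    toℕ-eval c x = toℕ-fromℕ< _

    ≡-mod⇒eval≡ : ∀ {n} (c c′ : Vec Bool n → Fin q) x → evalℤ (lift c) x ≡ evalℤ (lift c′) x mod + q → eval c x ≡ eval c′ x
    ≡-mod⇒eval≡ {n} c c′ x c≡c′ = toℕ-injective (begin
      toℕ (eval c x)                    ≡⟨ toℕ-eval c x ⟩
      evalSum c x (allVecs n) % q
        ≡⟨ ≡-mod⇒%≡% _ _ (subst₂ (λ u v → u ≡ v mod + q) (sym (evalSum≡evalℤ c x)) (sym (evalSum≡evalℤ c′ x)) c≡c′) ⟩
      evalSum c′ x (allVecs n) % q      ≡⟨ toℕ-eval c′ x ⟨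
      toℕ (eval c′ x)                   ∎)
      where open ≡-Reasoning

    eval≡⇒≡-mod : ∀ {n} (c c′ : Vec Bool n → Fin q) x → eval c x ≡ eval c′ x → evalℤ (lift c) x ≡ evalℤ (lift c′) x mod + q
    eval≡⇒≡-mod c c′ x c≡c′ = subst₂ (λ u v → u ≡ v mod + q) (evalSum≡evalℤ c x) (evalSum≡evalℤ c′ x)
      (%≡%⇒≡-mod _ _ (trans (sym (toℕ-eval c x)) (trans (cong toℕ c≡c′) (toℕ-eval c′ x))))

    toℕ-≡-mod⇒≡ : ∀ (i j : Fin q) → + toℕ i ≡ + toℕ j mod + q → i ≡ j
    toℕ-≡-mod⇒≡ i j i≡j =
      toℕ-injective (trans (sym (m<n⇒m%n≡m (toℕ<n i))) (trans (≡-mod⇒%≡% _ _ i≡j) (m<n⇒m%n≡m (toℕ<n j))))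

    reduce : ℤ → Fin q
    reduce z = fromℕ< (n%ℕd<d z q)

    reduce-≡-mod : ∀ z → + toℕ (reduce z) ≡ z mod + q
    reduce-≡-mod z = congruent (divides (- (z /ℕ q)) (begin
      + toℕ (reduce z) - z                       ≡⟨ cong₂ (λ r z → + r - z) (toℕ-fromℕ< (n%ℕd<d z q)) (a≡a%ℕn+[a/ℕn]*n z q) ⟩
      + (z %ℕ q) - (+ (z %ℕ q) + z /ℕ q * + q)   ≡⟨ cancel (+ (z %ℕ q)) (z /ℕ q) (+ q) ⟩
      - (z /ℕ q) * + q                           ∎))
      where
      open ≡-Reasoning
      cancel : ∀ r x q → r - (r + x * q) ≡ - x * q
      cancel = solve-∀

    reduce-0 : toℕ (reduce 0ℤ) ≡ 0
    reduce-0 = trans (toℕ-fromℕ< (n%ℕd<d 0ℤ q)) (m<n⇒m%n≡m (ℕ.>-nonZero⁻¹ q))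

    uniqueHomogeneousRepresentation : ∀ {n k d} → BinomialsInvertible (+ q) k d → d ℕ.≤ k → k ℕ.+ d ℕ.≤ n →
      (f : Vec Bool n → Fin q) → InP d k f →
      Σ[ a ∈ (Vec Bool n → Fin q) ] (SupportedOnH d a × Represents k a f) ×
        ((b : Vec Bool n → Fin q) → SupportedOnH d b → Represents k b f → (T : Vec Bool n) → weight T ≡ d → b T ≡ a T)
    uniqueHomogeneousRepresentation {n} {k} {d} inv d≤k k+d≤n f (c , deg , rep) = a , (supported , represents) , unique
      where
      existence = homogeneous-exists (+ q) inv (lift c) (λ S d<S → cong +_ (deg S d<S))
      a₀ = proj₁ existence
      a : Vec Bool n → Fin q
      a = reduce ∘ a₀
      supported : SupportedOnH d a
      supported T w≢d rewrite proj₁ (proj₂ existence) T w≢d = reduce-0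
      represents : Represents k a f
      represents x w≡k = trans (rep x w≡k) (≡-mod⇒eval≡ c a x (begin
        evalℤ (lift c) x    ≈⟨ proj₂ (proj₂ existence) x w≡k ⟨
        evalℤ a₀ x          ≈⟨ sumCube-cong-mod n (λ T → *-congʳ-mod (+ monomial T x) (reduce-≡-mod (a₀ T))) ⟨
        evalℤ (lift a) x    ∎))
        where open ≡-mod-Reasoning (+ q)
      unique : (b : Vec Bool n → Fin q) → SupportedOnH d b → Represents k b f → (T : Vec Bool n) → weight T ≡ d → b T ≡ a T
      unique b supported-b represents-b T w≡d = toℕ-≡-mod⇒≡ (b T) (a T) (congruent
        (homogeneous-vanishing (+ q) d inv d≤k k+d≤n δ homogeneous vanishes T w≡d))
        where
        δ : Vec Bool n → ℤ
        δ T = lift b T - lift a T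
        homogeneous : Homogeneous d δ
        homogeneous T w≢d rewrite supported-b T w≢d | supported T w≢d = refl
        vanishes : VanishesOnSlice (+ q) k δ
        vanishes x w≡k = subst (+ q ∣_) (sym (evalℤ-- (lift b) (lift a) x))
          (m∣a-b (eval≡⇒≡-mod b a x (trans (sym (represents-b x w≡k)) (represents x w≡k))))

open import Defs
open ResidueRepresentation using (uniqueHomogeneousRepresentation; good⇒binomialsInvertible)
open import Data.Nat using (ℕ; _+_; _^_; _≤_; _<_; NonZero)
open import Data.Nat.Primality using (Prime)
open import Data.Bool using (Bool)
open import Data.Vec using (Vec)
open import Data.Fin using (Fin)
open import Data.Product using (Σ; _×_)
open import Relation.Binary.PropositionalEquality using (_≡_; refl)

lemma4p3 : (p e q : ℕ) → Prime p → 0 < e → q ≡ p ^ e → .{{_ : NonZero p}} → .{{_ : NonZero q}} →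
    (n k d : ℕ) → 0 < d → d ≤ k → k + d ≤ n → Good p d k →
    (f : Vec Bool n → Fin q) → InP d k f →
    Σ (Vec Bool n → Fin q) λ a → (SupportedOnH d a × Represents k a f) ×
      ((b : Vec Bool n → Fin q) → SupportedOnH d b → Represents k b f →
        (T : Vec Bool n) → weight T ≡ d → b T ≡ a T)
lemma4p3 p e .(p ^ e) p-prime _ refl n k d _ d≤k k+d≤n good =
  uniqueHomogeneousRepresentation (good⇒binomialsInvertible p-prime e good) d≤k k+d≤n
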